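{- Let $n,m\ge1$ and $\alpha^1,\dots,\alpha^n,\beta^1,\dots,\beta^m\in\mathrm{ord}$. (1) If $\alpha^i<\alpha^1,\dots,\alpha^n,\beta^1,\dots,\beta^m$ for every $i\in\{1,\dots,n\}$, then $\alpha^i<\beta^1,\dots,\beta^m$ for every $i$. (2) Let $F_1\subseteq_f\mathrm{In}_{\alpha^1},\dots,F_n\subseteq_f\mathrm{In}_{\alpha^n}$ be finite lists. If $\alpha^i\le\alpha^1_{F_1},\dots,\alpha^n_{F_n},\beta^1,\dots,\beta^m$ for every $i\in\{1,\dots,n\}$, then $\alpha^i\le\beta^1,\dots,\beta^m$ for every $i$.
   Context: The setting is constructive. Let $\mathfrak F$ be a set of index sets containing $\mathbb N$ and every $\mathbb N_k=\{n\in\mathbb N:n<k\}$, closed (up to isomorphism) under finitely enumerated subsets, sets of finitely enumerated subsets, and disjoint unions indexed by elements of $\mathfrak F$. The set $\mathrm{ord}=\mathrm{ord}_{\mathfrak F}$ is defined inductively: a distinguished element $\underline 0$, and for every $I\in\mathfrak F$ and family $(\alpha_i)_{i\in I}$ in $\mathrm{ord}$ an element $\mathrm S(\alpha_i)_{i\in I}$. For $\alpha=\mathrm S(\alpha_i)_{i\in I}$, $\mathrm{In}_\alpha=I$; by convention $\mathrm{In}_{\underline0}=\emptyset$. For a finite list $F\subseteq_f\mathrm{In}_\alpha$, $\alpha_F$ is the list of the $\alpha_i$, $i\in F$. By simultaneous induction ($m\ge1$): $\alpha\le\beta^1,\dots,\beta^m$ means $\alpha_i<\beta^1,\dots,\beta^m$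 for all $i\in\mathrm{In}_\alpha$; $\alpha<\beta^1,\dots,\beta^m$ means there exist finite lists $F_k\subseteq_f\mathrm{In}_{\beta^k}$, not all empty, with $\alpha\le\beta^1_{F_1},\dots,\beta^m_{F_m}$ (the concatenated list). -}

module Defs where

open import Data.Nat using (ℕ; _<_)
open import Data.List using (List; []; _∷_; _++_; map)
open import Data.Product using (Σ; _×_; _,_)
open import Data.Unit using (⊤)
open import Data.Empty using (⊥)
open import Data.Sum using (_⊎_)
open import Relation.Binary.PropositionalEquality using (_≢_)
open import Function.Bundles using (_↔_)

-- A set 𝔉 of index sets, presented as a universe (codes + decoding).
record IndexSets : Set₁ where
  field
    U  : Set
    El : U → Set

record Closure (𝔉 : IndexSets) : Set where
  open IndexSets 𝔉
  field
    hasℕ   : Σ U λ c → El c ↔ ℕ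
    hasℕ<  : (k : ℕ) → Σ U λ c → El c ↔ Σ ℕ (λ n → n < k)
    -- finitely enumerated subsets of I (given by their enumerations)
    hasFin : (a : U) → Σ U λ c → El c ↔ List (El a)
    hasΣ   : (a : U) (b : El a → U) → Σ U λ c → El c ↔ Σ (El a) (λ i → El (b i))

module OrdDefs (𝔉 : IndexSets) where
  open IndexSets 𝔉

  data Ord : Set where
    𝟘 : Ord
    S : (a : U) → (El a → Ord) → Ord

  In : Ord → Set
  In 𝟘 = ⊥
  In (S a f) = El a

  at : (α : Ord) → In α → Ord
  at (S a f) i = f i

  atL : (α : Ord) → List (In α) → List Ord
  atL α F = map (at α) F

  Sel : List Ord → Set
  Sel [] = ⊤
  Sel (β ∷ βs) = List (In β) × Sel βs

  pick : (βs : List Ord) → Sel βs → List Ord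
  pick [] _ = []
  pick (β ∷ βs) (F , Fs) = atL β F ++ pick βs Fs

  NotAllEmpty : (βs : List Ord) → Sel βs → Set
  NotAllEmpty [] _ = ⊥
  NotAllEmpty (β ∷ βs) (F , Fs) = (F ≢ []) ⊎ NotAllEmpty βs Fs

  _≤*_ : Ord → List Ord → Set
  _<*_ : Ord → List Ord → Set
  𝟘 ≤* βs = ⊤
  S a f ≤* βs = (i : El a) → f i <* βs
  α <* βs = Σ (Sel βs) λ Fs → NotAllEmpty βs Fs × (α ≤* pick βs Fs)

{-# OPTIONS --safe #-}
-- For a list Y, γ < Y holds exactly when γ ≤ P for some nonempty list P of
-- children (components α_i of members α) of Y; hence both relations are
-- monotone in Y and transitive: γ ≤ X and X ≤ Y pointwise give γ ≤ Y.
-- The heart of the matter is the cancellation law δ < δ, Z ⟹ δ < Z, by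
-- induction on δ: from δ ≤ δ_F, Z each child in δ_F lies below δ_F, Z, and
-- cancelling these children one at a time (induction hypothesis plus
-- transitivity) leaves δ ≤ Z.  Cancelling the αⁱ one at a time gives (1),
-- cancelling the children in α_F gives (2).
module Submission where

open import Defs
open import Data.List using (List; []; _∷_; _++_)
open import Data.List.Properties using (++-conicalˡ; ++-conicalʳ)
open import Data.List.Relation.Unary.All as All using (All; []; _∷_)
open import Data.List.Relation.Unary.All.Properties using (++⁺; map⁺)
open import Data.List.Relation.Unary.Any using (here; there)
open import Data.List.Membership.Propositional using (_∈_)
open import Data.List.Relation.Binary.Subset.Propositional using (_⊆_)
open import Data.List.Relation.Binary.Subset.Propositional.Properties
  using (xs⊆x∷xs; xs⊆xs++ys; xs⊆ys++xs; ++⁺ʳ)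
open import Data.Product using (Σ; _×_; _,_)
open import Data.Sum using (inj₁; inj₂)
open import Data.Unit using (tt)
open import Data.Empty using (⊥-elim)
open import Relation.Binary.PropositionalEquality using (_≡_; _≢_; refl)

∈⇒≢[] : {A : Set} {x : A} {xs : List A} → x ∈ xs → xs ≢ []
∈⇒≢[] () refl

⊆-≢[] : {A : Set} {xs ys : List A} → xs ⊆ ys → xs ≢ [] → ys ≢ []
⊆-≢[] {xs = []}    _   xs≢[] = ⊥-elim (xs≢[] refl)
⊆-≢[] {xs = _ ∷ _} sub _     = ∈⇒≢[] (sub (here refl))

module Ordinals (𝔉 : IndexSets) where
  open IndexSets 𝔉
  open OrdDefs 𝔉

  Child : List Ord → Ord → Set
  Child Y γ = Σ Ord λ y → y ∈ Y × Σ (In y) λ i → at y i ≡ γ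

  Child-mono : ∀ {X Y γ} → X ⊆ Y → Child X γ → Child Y γ
  Child-mono sub (y , y∈X , i , eq) = y , sub y∈X , i , eq

  atL-children : ∀ {Y y} → y ∈ Y → (F : List (In y)) → All (Child Y) (atL y F)
  atL-children {y = y} y∈Y F = map⁺ (All.universal (λ i → y , y∈Y , i , refl) F)

  pick-children : ∀ Y Fs → All (Child Y) (pick Y Fs)
  pick-children []      _        = []
  pick-children (y ∷ Y) (F , Fs) =
    ++⁺ (atL-children (here refl) F) (All.map (Child-mono (xs⊆x∷xs Y y)) (pick-children Y Fs))

  NotAllEmpty⇒pick≢[] : ∀ Y Fs → NotAllEmpty Y Fs → pick Y Fs ≢ []
  NotAllEmpty⇒pick≢[] (y ∷ Y) ([]    , Fs) (inj₁ F≢[]) = ⊥-elim (F≢[] refl)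
  NotAllEmpty⇒pick≢[] (y ∷ Y) (_ ∷ _ , Fs) (inj₁ _)    = λ ()
  NotAllEmpty⇒pick≢[] (y ∷ Y) (F     , Fs) (inj₂ ne)   =
    λ eq → NotAllEmpty⇒pick≢[] Y Fs ne (++-conicalʳ (atL y F) _ eq)

  pick≢[]⇒NotAllEmpty : ∀ Y Fs → pick Y Fs ≢ [] → NotAllEmpty Y Fs
  pick≢[]⇒NotAllEmpty []      _           pick≢[] = pick≢[] refl
  pick≢[]⇒NotAllEmpty (y ∷ Y) ([]    , Fs) pick≢[] = inj₂ (pick≢[]⇒NotAllEmpty Y Fs pick≢[])
  pick≢[]⇒NotAllEmpty (y ∷ Y) (_ ∷ _ , Fs) _       = inj₁ (λ ())

  noneSel : ∀ Y → Sel Y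
  noneSel []      = tt
  noneSel (y ∷ Y) = [] , noneSel Y

  insertSel : ∀ Y {y} → y ∈ Y → In y → Sel Y → Sel Y
  insertSel (y ∷ Y) (here refl) i (F , Fs) = i ∷ F , Fs
  insertSel (y ∷ Y) (there y∈Y) i (F , Fs) = F , insertSel Y y∈Y i Fs

  at∈pick-insertSel : ∀ Y {y} (y∈Y : y ∈ Y) i Fs → at y i ∈ pick Y (insertSel Y y∈Y i Fs)
  at∈pick-insertSel (y ∷ Y) (here refl) i (F , Fs) = here refl
  at∈pick-insertSel (y ∷ Y) (there y∈Y) i (F , Fs) =
    xs⊆ys++xs _ (atL y F) (at∈pick-insertSel Y y∈Y i Fs)

  pick⊆pick-insertSel : ∀ Y {y} (y∈Y : y ∈ Y) i Fs → pick Y Fs ⊆ pick Y (insertSel Y y∈Y i Fs)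
  pick⊆pick-insertSel (y ∷ Y) (here refl) i (F , Fs) = xs⊆x∷xs _ (at y i)
  pick⊆pick-insertSel (y ∷ Y) (there y∈Y) i (F , Fs) =
    ++⁺ʳ (atL y F) (pick⊆pick-insertSel Y y∈Y i Fs)

  children⊆pick : ∀ {Y P} → All (Child Y) P → Σ (Sel Y) λ Fs → P ⊆ pick Y Fs
  children⊆pick {Y} [] = noneSel Y , λ ()
  children⊆pick {Y} ((y , y∈Y , i , refl) ∷ children) with children⊆pick children
  ... | Fs , P⊆pick = insertSel Y y∈Y i Fs , λ
    { (here refl) → at∈pick-insertSel Y y∈Y i Fs
    ; (there γ∈P) → pick⊆pick-insertSel Y y∈Y i Fs (P⊆pick γ∈P) }

  <*⇒children : ∀ {γ Y} → γ <* Y → Σ (List Ord) λ P → P ≢ [] × All (Child Y) P × γ ≤* P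
  <*⇒children {Y = Y} (Fs , ne , γ≤pick) =
    pick Y Fs , NotAllEmpty⇒pick≢[] Y Fs ne , pick-children Y Fs , γ≤pick

  <*⇒≢[] : ∀ {γ Y} → γ <* Y → Y ≢ []
  <*⇒≢[] {Y = []}    (_ , () , _)
  <*⇒≢[] {Y = _ ∷ _} _ = λ ()

  mutual
    ≤*-mono : ∀ {γ X Y} → X ⊆ Y → γ ≤* X → γ ≤* Y
    ≤*-mono {𝟘}     _   _   = tt
    ≤*-mono {S a f} X⊆Y γ≤X = λ i → <*-mono X⊆Y (γ≤X i)

    <*-mono : ∀ {γ X Y} → X ⊆ Y → γ <* X → γ <* Y
    <*-mono X⊆Y γ<X with <*⇒children γ<X
    ... | P , P≢[] , children , γ≤P = children⇒<* P≢[] (All.map (Child-mono X⊆Y) children) γ≤P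

    children⇒<* : ∀ {γ Y P} → P ≢ [] → All (Child Y) P → γ ≤* P → γ <* Y
    children⇒<* {Y = Y} P≢[] children γ≤P with children⊆pick children
    ... | Fs , P⊆pick =
      Fs , pick≢[]⇒NotAllEmpty Y Fs (⊆-≢[] P⊆pick P≢[]) , ≤*-mono P⊆pick γ≤P

  ∈⇒≤* : ∀ {γ Y} → γ ∈ Y → γ ≤* Y
  ∈⇒≤* {𝟘}     _   = tt
  ∈⇒≤* {S a f} γ∈Y = λ i →
    children⇒<* (λ ()) ((S a f , γ∈Y , i , refl) ∷ []) (∈⇒≤* (here refl))

  ≤*-refl : ∀ Y → All (_≤* Y) Y
  ≤*-refl Y = All.tabulate ∈⇒≤*

  Child⇒≤* : ∀ {γ Y} → Child Y γ → γ ≤* Y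
  Child⇒≤* {𝟘}     _       = tt
  Child⇒≤* {S a f} γ◃Y = λ i →
    children⇒<* (λ ()) (γ◃Y ∷ []) (Child⇒≤* {f i} (S a f , here refl , i , refl))

  Child⇒<* : ∀ {γ X Y} → Child X γ → All (_≤* Y) X → γ <* Y
  Child⇒<* (𝟘     , _   , () , _)   _
  Child⇒<* (S a f , x∈X , i  , refl) X≤Y = All.lookup X≤Y x∈X i

  <*-join : ∀ {Y P} → All (_<* Y) P →
            Σ (List Ord) λ R → (P ≢ [] → R ≢ []) × All (Child Y) R × All (_≤* R) P
  <*-join [] = [] , (λ P≢[] _ → P≢[] refl) , [] , []
  <*-join (p<Y ∷ P<Y) with <*⇒children p<Y | <*-join P<Y
  ... | Q , Q≢[] , Q◃Y , p≤Q | R , _ , R◃Y , P≤R =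
    Q ++ R , (λ _ eq → Q≢[] (++-conicalˡ Q R eq)) , ++⁺ Q◃Y R◃Y ,
    ≤*-mono (xs⊆xs++ys Q R) p≤Q ∷ All.map (≤*-mono (xs⊆ys++xs R Q)) P≤R

  mutual
    ≤*-trans : ∀ {γ X Y} → γ ≤* X → All (_≤* Y) X → γ ≤* Y
    ≤*-trans {𝟘}     _   _   = tt
    ≤*-trans {S a f} γ≤X X≤Y = λ i → <*-trans (γ≤X i) X≤Y

    <*-trans : ∀ {γ X Y} → γ <* X → All (_≤* Y) X → γ <* Y
    <*-trans γ<X X≤Y with <*⇒children γ<X
    ... | P , P≢[] , P◃X , γ≤P with <*-join (All.map (λ p◃X → Child⇒<* p◃X X≤Y) P◃X)
    ... | R , R≢[] , R◃Y , P≤R = children⇒<* (R≢[] P≢[]) R◃Y (≤*-trans γ≤P P≤R)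

  <*⇒≤* : ∀ {γ Y} → γ <* Y → γ ≤* Y
  <*⇒≤* γ<Y with <*⇒children γ<Y
  ... | _ , _ , P◃Y , γ≤P = ≤*-trans γ≤P (All.map Child⇒≤* P◃Y)

  prefix-below : ∀ {K B} → All (_<* B) K → All (_≤* B) (K ++ B)
  prefix-below {B = B} K<B = ++⁺ (All.map <*⇒≤* K<B) (≤*-refl B)

  Cancellable : Ord → Set
  Cancellable δ = ∀ Z → δ <* (δ ∷ Z) → δ <* Z

  cancel-prefix : ∀ K {B} → All Cancellable K → All (_<* (K ++ B)) K → All (_<* B) K
  cancel-prefix []      _                       _               = []
  cancel-prefix (k ∷ K) {B} (cancel-k ∷ cancel-K) (k<kKB ∷ K<kKB) =
    <*-trans k<KB (prefix-below K<B) ∷ K<B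
    where
    k<KB : k <* (K ++ B)
    k<KB = cancel-k (K ++ B) k<kKB
    K<B : All (_<* B) K
    K<B = cancel-prefix K cancel-K (All.map (λ q< → <*-trans q< (prefix-below (k<KB ∷ []))) K<kKB)

  cancel-children : ∀ {αs βs L} → All (Child αs) L → All Cancellable L →
                    All (_≤* (L ++ βs)) αs → All (_≤* βs) αs
  cancel-children {βs = βs} {L} L◃αs cancel-L αs≤ =
    All.map (λ α≤ → ≤*-trans α≤ (prefix-below L<βs)) αs≤
    where
    L<βs : All (_<* βs) L
    L<βs = cancel-prefix L cancel-L (All.map (λ l◃αs → Child⇒<* l◃αs αs≤) L◃αs)

  cancellable : ∀ δ → Cancellable δ
  cancellable 𝟘       Z (([] , Fs) , inj₁ F≢[] , _) = ⊥-elim (F≢[] refl)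
  cancellable 𝟘       Z ((_  , Fs) , inj₂ ne   , _) = Fs , ne , tt
  cancellable (S a f) Z ((F  , Fs) , ne , δ≤) = Fs , NotAllEmpty-Z ne , δ≤PZ
    where
    δ≤PZ : S a f ≤* pick Z Fs
    δ≤PZ = All.head (cancel-children (atL-children (here refl) F)
                                     (map⁺ (All.universal (λ i → cancellable (f i)) F))
                                     (δ≤ ∷ []))
    pick≢[] : (F : List (El a)) → F ≢ [] → pick Z Fs ≢ []
    pick≢[] []      F≢[] = ⊥-elim (F≢[] refl)
    pick≢[] (i ∷ _) _    = <*⇒≢[] (δ≤PZ i)
    NotAllEmpty-Z : NotAllEmpty (S a f ∷ Z) (F , Fs) → NotAllEmpty Z Fs
    NotAllEmpty-Z (inj₁ F≢[]) = pick≢[]⇒NotAllEmpty Z Fs (pick≢[] F F≢[])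
    NotAllEmpty-Z (inj₂ ne)   = ne

lemma4p6 : (𝔉 : IndexSets) → Closure 𝔉 →
    let open OrdDefs 𝔉 in
    (αs βs : List Ord) → αs ≢ [] → βs ≢ [] →
      (All (λ α → α <* (αs ++ βs)) αs → All (λ α → α <* βs) αs)
      × ((Fs : Sel αs) →
           All (λ α → α ≤* (pick αs Fs ++ βs)) αs → All (λ α → α ≤* βs) αs)
lemma4p6 𝔉 _ αs βs _ _ =
  cancel-prefix αs (all-cancellable αs) ,
  λ Fs → cancel-children (pick-children αs Fs) (all-cancellable (pick αs Fs))
  where
  open OrdDefs 𝔉
  open Ordinals 𝔉
  all-cancellable : ∀ K → All Cancellable K
  all-cancellable = All.universal cancellable
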